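{- Let $\mathcal{I}$ be an ideal on $\omega$. Then $\mathfrak{b}_R(\mathcal{I})\leq\mathfrak{c}$ if and only if there exists a partition $\{A_n:n<\omega\}$ of $\omega$ such that $A_n\in\mathcal{I}^+$ for each $n$ and for every $C\subseteq\omega$ with $C\cap A_n\in\mathcal{I}$ for all $n$, there exists $B\in\mathcal{I}^+$ with $B\cap C=\emptyset$ and $B\cap A_n\in\mathcal{I}$ for all $n$.
   Context: An ideal on a countable infinite set $X$ is a nonempty family $\mathcal{I}\subseteq\mathcal{P}(X)$ closed under finite unions and under subsets, containing all finite subsets of $X$, and with $X\notin\mathcal{I}$; $\mathcal{I}^+=\{A\subseteq X: A\notin\mathcal{I}\}$. Families $\mathcal{A},\mathcal{B}\subseteq\mathcal{P}(X)$ are $\mathcal{I}$-orthogonal if $A\cap B\in\mathcal{I}$ for all $A\in\mathcal{A}$, $B\in\mathcal{B}$. A set $C\subseteq X$ $\mathcal{I}$-separates $(\mathcal{A},\mathcal{B})$ if $A\cap C\in\mathcal{I}$ and $B\setminus C\in\mathcal{I}$ for all $A\in\mathcal{A}$, $B\in\mathcal{B}$. An $\mathcal{I}$-gap is a pair $(\mathcal{A},\mathcal{B})$ of $\mathcal{I}$-orthogonal subfamilies of $\mathcal{I}^+$ which is not $\mathcal{I}$-separated by any $C\subseteq X$; it is an $\mathcal{I}$-$(\kappa,\lambda)$-gap if $|\mathcal{A}|=\kappa$ and $|\mathcal{B}|=\lambda$. The Rothberger number $\mathfrak{b}_R(\mathcal{I})$ is the least cardinal $\kappa$ such that there is an $\mathcal{I}$-$(\omega,\kappa)$-gap,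 and $\mathfrak{b}_R(\mathcal{I})=\mathfrak{c}^+$ if no such gap exists. $\mathfrak{c}=2^{\aleph_0}$. -}

module Defs where

open import Level using (Level; suc; _⊔_) renaming (zero to lzero)
open import Data.Nat using (ℕ; _<_)
open import Data.Bool using (Bool; true; false; _∧_; _∨_; not)
open import Data.Product using (Σ; Σ-syntax; ∃; _×_; _,_)
open import Relation.Binary.PropositionalEquality using (_≡_)
open import Relation.Nullary using (¬_; Dec)

-- Subsets of ω, as characteristic functions (classically = P(ω)).
Subset : Set
Subset = ℕ → Bool

_∈ₛ_ : ℕ → Subset → Set
k ∈ₛ S = S k ≡ true

_⊆ₛ_ : Subset → Subset → Set
S ⊆ₛ T = ∀ k → k ∈ₛ S → k ∈ₛ T

_∩ₛ_ : Subset → Subset → Subset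
(S ∩ₛ T) k = S k ∧ T k

_∪ₛ_ : Subset → Subset → Subset
(S ∪ₛ T) k = S k ∨ T k

_∖ₛ_ : Subset → Subset → Subset
(S ∖ₛ T) k = S k ∧ not (T k)

∅ₛ : Subset
∅ₛ _ = false

ωₛ : Subset
ωₛ _ = true

_≐_ : Subset → Subset → Set
S ≐ T = ∀ k → S k ≡ T k

Finite : Subset → Set
Finite S = Σ[ n ∈ ℕ ] (∀ k → k ∈ₛ S → k < n)

Family : Set₁
Family = Subset → Set

-- Ideal on ω (nonemptiness follows from containing finite sets).
record IsIdeal (I : Family) : Set where
  field
    subset-closed : ∀ S T → S ⊆ₛ T → I T → I S
    union-closed  : ∀ S T → I S → I T → I (S ∪ₛ T)
    finite-in     : ∀ S → Finite S → I S
    ω-notin       : ¬ I ωₛ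

Pos : Family → Subset → Set
Pos I S = ¬ I S

-- An I-gap (A, B) where A is a countably infinite family, given as an
-- injective (up to extensional equality) enumeration ℕ → Subset,
-- and B is an arbitrary family of subsets of ω.
record IsωGap (I : Family) (A : ℕ → Subset) (B : Family) : Set where
  field
    A-injective : ∀ m n → A m ≐ A n → m ≡ n
    A-pos       : ∀ n → Pos I (A n)
    B-pos       : ∀ X → B X → Pos I X
    orthogonal  : ∀ n X → B X → I (A n ∩ₛ X)
    not-separated :
      ¬ (Σ[ C ∈ Subset ] ((∀ n → I (A n ∩ₛ C)) × (∀ X → B X → I (X ∖ₛ C))))

-- 𝔟_R(I) ≤ 𝔠 : there is an I-(ω,κ)-gap for some κ ≤ 𝔠.  Every family of
-- subsets of ω has cardinality ≤ 𝔠, so this says: some I-(ω,κ)-gap exists.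
bR≤c : Family → Set₁
bR≤c I = Σ[ A ∈ (ℕ → Subset) ] Σ[ B ∈ Family ] IsωGap I A B

IsPartition : (ℕ → Subset) → Set
IsPartition A = ∀ k → Σ[ n ∈ ℕ ] (k ∈ₛ A n × (∀ m → k ∈ₛ A m → m ≡ n))

LEM : Set₁
LEM = (P : Set) → Dec P

-- Given a gap (Aₙ, B), let first x be the least n with x ∈ Aₙ.  The levels
-- {x : first x = m} cannot all be I-small from some N on, for otherwise the
-- points that are uncovered or of level ≥ N would separate the gap.  Grouping
-- consecutive levels into blocks, each ending at an I-positive level, gives an
-- I-positive partition in which every Aₙ meets only finitely many blocks and
-- the covered points of every block lie in finitely many Aₙ.  If C is small on
-- every block, then C ∪ uncovered is small on every Aₙ, so some X ∈ B has
-- X ∖ (C ∪ uncovered) I-positive, and that set is the required witness.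
-- Conversely, the positive sets that are small on every piece of such a
-- partition form a gap with it.
module Submission where

open import Defs
open import Data.Nat using (ℕ)
open import Data.Product using (Σ; Σ-syntax; _×_)
open import Function.Bundles using (_⇔_)

open import Data.Bool using (Bool; true; false; _∧_; _∨_; not; if_then_else_)
open import Data.Bool.Properties using (∧-conicalˡ; ∧-conicalʳ; ∨-conicalˡ; ∨-conicalʳ; ∨-zeroʳ; ∧-zeroʳ; not-injective; T-≡)
open import Data.Nat using (zero; suc; _≤_; _<_; z≤n; s≤s; _≤ᵇ_; _≡ᵇ_; _+_; _∸_; _≤?_; _≟_)
open import Data.Nat.Properties
open import Data.Product using (_,_)
open import Data.Sum using (inj₁; inj₂)
open import Function.Bundles using (mk⇔; Equivalence)
open import Relation.Nullary using (¬_; Dec; yes; no; contradiction)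
open import Relation.Unary using (Pred; Decidable)
open import Relation.Binary.PropositionalEquality using (_≡_; refl; sym; trans; cong; subst)

module _ (S T : Subset) (x : ℕ) where

  ∈-∩⁺ : x ∈ₛ S → x ∈ₛ T → x ∈ₛ (S ∩ₛ T)
  ∈-∩⁺ x∈S x∈T rewrite x∈S | x∈T = refl

  ∈-∩⁻ˡ : x ∈ₛ (S ∩ₛ T) → x ∈ₛ S
  ∈-∩⁻ˡ = ∧-conicalˡ (S x) (T x)

  ∈-∩⁻ʳ : x ∈ₛ (S ∩ₛ T) → x ∈ₛ T
  ∈-∩⁻ʳ = ∧-conicalʳ (S x) (T x)

  ∉-∩⁻ʳ : x ∈ₛ S → (S ∩ₛ T) x ≡ false → T x ≡ false
  ∉-∩⁻ʳ x∈S x∉S∩T rewrite x∈S = x∉S∩T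

  ∈-∪⁻ˡ : x ∈ₛ (S ∪ₛ T) → T x ≡ false → x ∈ₛ S
  ∈-∪⁻ˡ x∈S∪T x∉T with S x
  ... | true = refl
  ... | false = trans (sym x∉T) x∈S∪T

  ∉-∪⁻ˡ : (S ∪ₛ T) x ≡ false → S x ≡ false
  ∉-∪⁻ˡ = ∨-conicalˡ (S x) (T x)

  ∉-∪⁻ʳ : (S ∪ₛ T) x ≡ false → T x ≡ false
  ∉-∪⁻ʳ = ∨-conicalʳ (S x) (T x)

  ∈-∪⁺ˡ : x ∈ₛ S → x ∈ₛ (S ∪ₛ T)
  ∈-∪⁺ˡ x∈S rewrite x∈S = refl

  ∈-∪⁺ʳ : x ∈ₛ T → x ∈ₛ (S ∪ₛ T)
  ∈-∪⁺ʳ x∈T rewrite x∈T = ∨-zeroʳ (S x)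

  ∈-∖⁺ : x ∈ₛ S → T x ≡ false → x ∈ₛ (S ∖ₛ T)
  ∈-∖⁺ x∈S x∉T rewrite x∈S | x∉T = refl

  ∈-∖⁻ˡ : x ∈ₛ (S ∖ₛ T) → x ∈ₛ S
  ∈-∖⁻ˡ = ∧-conicalˡ (S x) (not (T x))

  ∈-∖⁻ʳ : x ∈ₛ (S ∖ₛ T) → T x ≡ false
  ∈-∖⁻ʳ x∈S∖T = not-injective (∧-conicalʳ (S x) (not (T x)) x∈S∖T)

∩-comm-⊆ : ∀ S T → (S ∩ₛ T) ⊆ₛ (T ∩ₛ S)
∩-comm-⊆ S T x x∈ = ∈-∩⁺ T S x (∈-∩⁻ʳ S T x x∈) (∈-∩⁻ˡ S T x x∈)

∖-∪-∩-empty : ∀ S T U → ((S ∖ₛ (T ∪ₛ U)) ∩ₛ T) ≐ ∅ₛ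
∖-∪-∩-empty S T U x = pointwise (S x) (T x) (U x)
  where
  pointwise : ∀ a b c → (a ∧ not (b ∨ c)) ∧ b ≡ false
  pointwise false b c = refl
  pointwise true true c = refl
  pointwise true false c = ∧-zeroʳ (not c)

fibre : (ℕ → ℕ) → ℕ → Subset
fibre g m x = g x ≡ᵇ m

module _ (g : ℕ → ℕ) {m : ℕ} (x : ℕ) where

  ∈-fibre⁺ : g x ≡ m → x ∈ₛ fibre g m
  ∈-fibre⁺ gx≡m = Equivalence.to T-≡ (≡⇒≡ᵇ (g x) m gx≡m)

  ∈-fibre⁻ : x ∈ₛ fibre g m → g x ≡ m
  ∈-fibre⁻ x∈ = ≡ᵇ⇒≡ (g x) m (Equivalence.from T-≡ x∈)

fibre-partition : ∀ g → IsPartition (fibre g)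
fibre-partition g x = g x , ∈-fibre⁺ g x refl , λ m x∈ → sym (∈-fibre⁻ g x x∈)

≤ᵇ≡false⇒> : ∀ m n → (m ≤ᵇ n) ≡ false → n < m
≤ᵇ≡false⇒> m n m≰ᵇn = ≰⇒> λ m≤n → contradiction (trans (sym (Equivalence.to T-≡ (≤⇒≤ᵇ m≤n))) m≰ᵇn) λ ()

module IdealProperties {I : Family} (ideal : IsIdeal I) where
  open IsIdeal ideal

  ⊆-∈I : ∀ {S T} → S ⊆ₛ T → I T → I S
  ⊆-∈I {S} {T} = subset-closed S T

  ⊇-Pos : ∀ {S T} → S ⊆ₛ T → Pos I S → Pos I T
  ⊇-Pos S⊆T S⁺ T∈I = S⁺ (⊆-∈I S⊆T T∈I)

  Pos⇒nonempty : LEM → ∀ {S} → Pos I S → Σ[ x ∈ ℕ ] x ∈ₛ S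
  Pos⇒nonempty lem {S} S⁺ with lem (Σ[ x ∈ ℕ ] x ∈ₛ S)
  ... | yes nonempty = nonempty
  ... | no empty = contradiction (finite-in S (0 , λ x x∈S → contradiction (x , x∈S) empty)) S⁺

  finitely-covered⇒∈I : ∀ (F : ℕ → Subset) n {S} → (∀ j → j ≤ n → I (F j)) →
                        (∀ x → x ∈ₛ S → Σ[ j ∈ ℕ ] (j ≤ n × x ∈ₛ F j)) → I S
  finitely-covered⇒∈I F n F∈I cover =
    ⊆-∈I (λ x x∈S → let j , j≤n , x∈Fj = cover x x∈S in ∈-⋃≤ n j≤n x∈Fj) (⋃≤-∈I n F∈I)
    where
    ⋃≤ : ℕ → Subset
    ⋃≤ zero = F zero
    ⋃≤ (suc n) = ⋃≤ n ∪ₛ F (suc n)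

    ⋃≤-∈I : ∀ n → (∀ j → j ≤ n → I (F j)) → I (⋃≤ n)
    ⋃≤-∈I zero F∈I = F∈I 0 z≤n
    ⋃≤-∈I (suc n) F∈I =
      union-closed _ _ (⋃≤-∈I n λ j j≤n → F∈I j (m≤n⇒m≤1+n j≤n)) (F∈I (suc n) ≤-refl)

    ∈-⋃≤ : ∀ n {j x} → j ≤ n → x ∈ₛ F j → x ∈ₛ ⋃≤ n
    ∈-⋃≤ zero z≤n x∈Fj = x∈Fj
    ∈-⋃≤ (suc n) j≤1+n x∈Fj with m≤n⇒m<n∨m≡n j≤1+n
    ... | inj₁ j<1+n = ∈-∪⁺ˡ (⋃≤ n) (F (suc n)) _ (∈-⋃≤ n (≤-pred j<1+n) x∈Fj)
    ... | inj₂ refl = ∈-∪⁺ʳ (⋃≤ n) (F (suc n)) _ x∈Fj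

-- least p w is the least j ≤ w with p j, and w when there is none.
least : (ℕ → Bool) → ℕ → ℕ
least p zero = zero
least p (suc w) = if p (least p w) then least p w else suc w

least-holds : ∀ (p : ℕ → Bool) w {j} → p j ≡ true → j ≤ w → p (least p w) ≡ true
least-holds p zero pj z≤n = pj
least-holds p (suc w) pj j≤1+w with p (least p w) in eq
... | true = eq
... | false with m≤n⇒m<n∨m≡n j≤1+w
...   | inj₁ j<1+w = contradiction (trans (sym (least-holds p w pj (≤-pred j<1+w))) eq) λ ()
...   | inj₂ refl = pj

least-minimal : ∀ (p : ℕ → Bool) w {j} → p j ≡ true → least p w ≤ j
least-minimal p zero pj = z≤n
least-minimal p (suc w) {j} pj with p (least p w) in eq
... | true = least-minimal p w pj
... | false with j ≤? w
...   | yes j≤w = contradiction (trans (sym (least-holds p w pj j≤w)) eq) λ ()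
...   | no j≰w = ≰⇒> j≰w

module Counting {ℓ} {P : Pred ℕ ℓ} (P? : Decidable P) where

  count : ℕ → ℕ
  count zero = zero
  count (suc m) with P? m
  ... | yes _ = suc (count m)
  ... | no _ = count m

  count-≤ : ∀ m → count m ≤ m
  count-≤ zero = z≤n
  count-≤ (suc m) with P? m
  ... | yes _ = s≤s (count-≤ m)
  ... | no _ = m≤n⇒m≤1+n (count-≤ m)

  count-≤-suc : ∀ m → count m ≤ count (suc m)
  count-≤-suc m with P? m
  ... | yes _ = n≤1+n (count m)
  ... | no _ = ≤-refl

  count-mono : ∀ {m m′} → m ≤ m′ → count m ≤ count m′
  count-mono {m′ = zero} z≤n = ≤-refl
  count-mono {m′ = suc m′} m≤1+m′ with m≤n⇒m<n∨m≡n m≤1+m′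
  ... | inj₁ m<1+m′ = ≤-trans (count-mono (≤-pred m<1+m′)) (count-≤-suc m′)
  ... | inj₂ refl = ≤-refl

  count-<⇒< : ∀ {m m′} → count m < count m′ → m < m′
  count-<⇒< {m} {m′} count< = ≰⇒> λ m′≤m → <⇒≱ count< (count-mono m′≤m)

  count-suc : ∀ {m} → P m → count (suc m) ≡ suc (count m)
  count-suc {m} Pm with P? m
  ... | yes _ = refl
  ... | no ¬Pm = contradiction Pm ¬Pm

  count-unbounded : (∀ N → Σ[ m ∈ ℕ ] (N ≤ m × P m)) → ∀ k → Σ[ M ∈ ℕ ] k ≤ count M
  count-unbounded unbounded zero = 0 , z≤n
  count-unbounded unbounded (suc k) =
    let M , k≤count = count-unbounded unbounded k
        m , M≤m , Pm = unbounded M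
    in suc m , subst (suc k ≤_) (sym (count-suc Pm)) (s≤s (≤-trans k≤count (count-mono M≤m)))

  count-hits : ∀ {k} M → k < count M → Σ[ m ∈ ℕ ] (count m ≡ k × P m)
  count-hits {k} (suc M) k<count with P? M
  ... | no _ = count-hits M k<count
  ... | yes PM with k ≟ count M
  ...   | yes refl = M , refl , PM
  ...   | no k≢count = count-hits M (≤∧≢⇒< (≤-pred k<count) k≢count)

module GapToPartition (lem : LEM) {I : Family} (ideal : IsIdeal I)
                      {A : ℕ → Subset} {B : Family} (gap : IsωGap I A B) where
  open IsωGap gap
  open IdealProperties ideal

  stable : ∀ {P : Set} → ¬ ¬ P → P
  stable {P} ¬¬p with lem P
  ... | yes p = p
  ... | no ¬p = contradiction ¬p ¬¬p

  unseparated : ∀ C → (∀ n → I (A n ∩ₛ C)) → Σ[ X ∈ Subset ] (B X × Pos I (X ∖ₛ C))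
  unseparated C A∩C∈I = stable λ none →
    not-separated (C , A∩C∈I , λ X X∈B → stable λ X∖C⁺ → none (X , X∈B , X∖C⁺))

  covered? : ∀ x → Dec (Σ[ n ∈ ℕ ] x ∈ₛ A n)
  covered? x = lem (Σ[ n ∈ ℕ ] x ∈ₛ A n)

  uncovered : Subset
  uncovered x with covered? x
  ... | yes _ = false
  ... | no _ = true

  -- uncovered points get the junk value 0, so they lie in level 0
  first : ℕ → ℕ
  first x with covered? x
  ... | yes (n , _) = least (λ m → A m x) n
  ... | no _ = 0

  first-≤ : ∀ {n x} → x ∈ₛ A n → first x ≤ n
  first-≤ {n} {x} x∈An with covered? x
  ... | yes (w , _) = least-minimal (λ m → A m x) w x∈An
  ... | no uncov = contradiction (n , x∈An) uncov

  ∈-A-first : ∀ {x} → uncovered x ≡ false → x ∈ₛ A (first x)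
  ∈-A-first {x} cov with covered? x
  ... | yes (w , x∈Aw) = least-holds (λ m → A m x) w x∈Aw ≤-refl

  ∈-A⇒covered : ∀ {n x} → x ∈ₛ A n → uncovered x ≡ false
  ∈-A⇒covered {n} {x} x∈An with covered? x
  ... | yes _ = refl
  ... | no uncov = contradiction (n , x∈An) uncov

  level : ℕ → Subset
  level = fibre first

  positive-levels-unbounded : ∀ N → Σ[ m ∈ ℕ ] (N ≤ m × Pos I (level m))
  positive-levels-unbounded N = stable λ none →
    let X , X∈B , X∖C⁺ = unseparated C (A∩C∈I none) in X∖C⁺ (X∖C∈I X X∈B)
    where
    beyond : Subset
    beyond x = N ≤ᵇ first x

    C : Subset
    C = beyond ∪ₛ uncovered

    A∩C∈I : ¬ (Σ[ m ∈ ℕ ] (N ≤ m × Pos I (level m))) → ∀ n → I (A n ∩ₛ C)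
    A∩C∈I none n = finitely-covered⇒∈I (λ j → level (N + j)) n
      (λ j _ → stable λ level⁺ → none (N + j , m≤m+n N j , level⁺)) cover
      where
      cover : ∀ x → x ∈ₛ (A n ∩ₛ C) → Σ[ j ∈ ℕ ] (j ≤ n × x ∈ₛ level (N + j))
      cover x x∈ = first x ∸ N , ≤-trans (m∸n≤m (first x) N) (first-≤ x∈An) ,
                   ∈-fibre⁺ first x (sym (m+[n∸m]≡n N≤first))
        where
        x∈An : x ∈ₛ A n
        x∈An = ∈-∩⁻ˡ (A n) C x x∈
        N≤first : N ≤ first x
        N≤first = ≤ᵇ⇒≤ N (first x) (Equivalence.from T-≡
          (∈-∪⁻ˡ beyond uncovered x (∈-∩⁻ʳ (A n) C x x∈) (∈-A⇒covered x∈An)))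

    X∖C∈I : ∀ X → B X → I (X ∖ₛ C)
    X∖C∈I X X∈B = finitely-covered⇒∈I (λ j → A j ∩ₛ X) N (λ j _ → orthogonal j X X∈B) cover
      where
      cover : ∀ x → x ∈ₛ (X ∖ₛ C) → Σ[ j ∈ ℕ ] (j ≤ N × x ∈ₛ (A j ∩ₛ X))
      cover x x∈ = first x , <⇒≤ (≤ᵇ≡false⇒> N (first x) (∉-∪⁻ˡ beyond uncovered x x∉C)) ,
                   ∈-∩⁺ (A (first x)) X x (∈-A-first (∉-∪⁻ʳ beyond uncovered x x∉C))
                     (∈-∖⁻ˡ X C x x∈)
        where
        x∉C : C x ≡ false
        x∉C = ∈-∖⁻ʳ X C x x∈

  open Counting (λ m → lem (Pos I (level m)))

  rank : ℕ → ℕ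
  rank x = count (first x)

  -- block k consists of the levels after the k-th positive level, up to and
  -- including the (k+1)-st positive level
  block : ℕ → Subset
  block = fibre rank

  block-partition : IsPartition block
  block-partition = fibre-partition rank

  block-positive : ∀ k → Pos I (block k)
  block-positive k =
    let M , k<count = count-unbounded positive-levels-unbounded (suc k)
        m , count≡k , level⁺ = count-hits M k<count
    in ⊇-Pos (λ x x∈ → ∈-fibre⁺ rank x (trans (cong count (∈-fibre⁻ first x x∈)) count≡k))
             level⁺

  block-levels-bounded : ∀ k → Σ[ M ∈ ℕ ] (∀ x → x ∈ₛ block k → first x < M)
  block-levels-bounded k =
    let M , k<count = count-unbounded positive-levels-unbounded (suc k)
    in M , λ x x∈ → count-<⇒< (subst (_< count M) (sym (∈-fibre⁻ rank x x∈)) k<count)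

  block-property : ∀ C → (∀ n → I (C ∩ₛ block n)) →
    Σ[ D ∈ Subset ] (Pos I D × (D ∩ₛ C) ≐ ∅ₛ × (∀ n → I (D ∩ₛ block n)))
  block-property C C∩block∈I =
    let X , X∈B , X∖C′⁺ = unseparated C′ A∩C′∈I
    in X ∖ₛ C′ , X∖C′⁺ , ∖-∪-∩-empty X C uncovered , X∖C′∩block∈I X X∈B
    where
    C′ : Subset
    C′ = C ∪ₛ uncovered

    A∩C′∈I : ∀ n → I (A n ∩ₛ C′)
    A∩C′∈I n = finitely-covered⇒∈I (λ k → C ∩ₛ block k) n (λ k _ → C∩block∈I k) cover
      where
      cover : ∀ x → x ∈ₛ (A n ∩ₛ C′) → Σ[ k ∈ ℕ ] (k ≤ n × x ∈ₛ (C ∩ₛ block k))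
      cover x x∈ = count (first x) , ≤-trans (count-≤ (first x)) (first-≤ x∈An) ,
                   ∈-∩⁺ C (block (rank x)) x
                     (∈-∪⁻ˡ C uncovered x (∈-∩⁻ʳ (A n) C′ x x∈) (∈-A⇒covered x∈An))
                     (∈-fibre⁺ rank x refl)
        where
        x∈An : x ∈ₛ A n
        x∈An = ∈-∩⁻ˡ (A n) C′ x x∈

    X∖C′∩block∈I : ∀ X → B X → ∀ k → I ((X ∖ₛ C′) ∩ₛ block k)
    X∖C′∩block∈I X X∈B k =
      let M , bounded = block-levels-bounded k
      in finitely-covered⇒∈I (λ j → A j ∩ₛ X) M (λ j _ → orthogonal j X X∈B) λ x x∈ →
           let x∈X∖C′ = ∈-∩⁻ˡ (X ∖ₛ C′) (block k) x x∈
           in first x , <⇒≤ (bounded x (∈-∩⁻ʳ (X ∖ₛ C′) (block k) x x∈)) ,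
              ∈-∩⁺ (A (first x)) X x (∈-A-first (∉-∪⁻ʳ C uncovered x (∈-∖⁻ʳ X C′ x x∈X∖C′)))
                (∈-∖⁻ˡ X C′ x x∈X∖C′)

module PartitionToGap (lem : LEM) {I : Family} (ideal : IsIdeal I) {A : ℕ → Subset}
                      (partition : IsPartition A) (A⁺ : ∀ n → Pos I (A n))
                      (property : ∀ C → (∀ n → I (C ∩ₛ A n)) →
                        Σ[ D ∈ Subset ] (Pos I D × (D ∩ₛ C) ≐ ∅ₛ × (∀ n → I (D ∩ₛ A n))))
                      where
  open IdealProperties ideal

  small-on-pieces : Family
  small-on-pieces X = Pos I X × (∀ n → I (X ∩ₛ A n))

  A-injective : ∀ m n → A m ≐ A n → m ≡ n
  A-injective m n Am≐An =
    let x , x∈Am = Pos⇒nonempty lem (A⁺ m)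
        _ , _ , unique = partition x
    in trans (unique m x∈Am) (sym (unique n (trans (sym (Am≐An x)) x∈Am)))

  unseparated : ¬ (Σ[ C ∈ Subset ] ((∀ n → I (A n ∩ₛ C)) × (∀ X → small-on-pieces X → I (X ∖ₛ C))))
  unseparated (C , A∩C∈I , X∖C∈I) =
    let D , D⁺ , D∩C≐∅ , D∩A∈I = property C (λ n → ⊆-∈I (∩-comm-⊆ C (A n)) (A∩C∈I n))
    in D⁺ (⊆-∈I (λ x x∈D → ∈-∖⁺ D C x x∈D (∉-∩⁻ʳ D C x x∈D (D∩C≐∅ x)))
                (X∖C∈I D (D⁺ , D∩A∈I)))

  gap : IsωGap I A small-on-pieces
  gap = record
    { A-injective = A-injective
    ; A-pos = A⁺
    ; B-pos = λ X (X⁺ , _) → X⁺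
    ; orthogonal = λ n X (_ , X∩A∈I) → ⊆-∈I (∩-comm-⊆ (A n) X) (X∩A∈I n)
    ; not-separated = unseparated
    }

lemma2p1 : LEM → (I : Family) → IsIdeal I →
    (bR≤c I ⇔
      (Σ[ A ∈ (ℕ → Subset) ]
        (IsPartition A × (∀ n → Pos I (A n)) ×
          (∀ (C : Subset) → (∀ n → I (C ∩ₛ A n)) →
            Σ[ B ∈ Subset ] (Pos I B × (B ∩ₛ C) ≐ ∅ₛ × (∀ n → I (B ∩ₛ A n)))))))
lemma2p1 lem I ideal = mk⇔
  (λ (_ , _ , gap) → let open GapToPartition lem ideal gap in
    block , block-partition , block-positive , block-property)
  (λ (A , partition , A⁺ , property) →
    A , _ , PartitionToGap.gap lem ideal partition A⁺ property)
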